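{- If $A,B,C$ are multinomials, and $F,G$ match terms of $A \cdot C$ and $B \cdot C$ (i.e. $F: A \times C \equiv B \times C$ and $G: B \times C \equiv A \times C$ are bijections between the terms of the products $A\cdot C$ and $B\cdot C$), then $(F,G)$ is X-divisible for any extreme monomial $\omega$ of $C$.
   Context: Write $f: A \equiv B$ ("$f$ matches $A$ with $B$") to mean that we know a suitable bijection $f$ from $A$ to $B$ together with its inverse. Suppose $F:A \times C \equiv B \times C$ and $G:B \times C \equiv A \times C$ (one may take $G=F^{ -1}$, but this is not required). For $\omega \in C$, define $\operatorname{xdiv}((F,G),\omega)=(f,g)$, where $f$ is a partial function on $A$ and $g$ a partial function on $B$, defined by the mutual recursion $f(x) = ((y,z):=F((x,\omega));\ \textbf{while } z \neq \omega \textbf{ do } (y,z):=F((g(y),z));\ \textbf{return } y)$, $g(x) = ((y,z):=G((x,\omega));\ \textbf{while } z \neq \omega \textbf{ do } (y,z):=G((f(y),z));\ \textbf{return } y)$. If both $f$ and $g$ are total, the pair $(F,G)$ is called X-divisible for $\omega$, and $\omega$ is called an extreme point for $(F,G)$. Here the multinomials are polynomials (in one or several variables) viewed as collections of terms (monomials), and an extreme monomial $\omega$ of $C$ is a monomial that is the unique maximizer of some linear function on the space of degrees (a singleton monomial on the boundary of the Newton polytope of $C$). -}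

module Defs where

open import Data.Nat using (ℕ)
open import Data.Integer using (ℤ; +_; _*_; _+_; _<_)
open import Data.Fin using (Fin)
open import Data.Vec using (Vec; []; _∷_; zipWith)
import Data.Vec as Vec
open import Data.Product using (_×_; _,_; Σ; ∃)
open import Relation.Binary.PropositionalEquality using (_≡_; _≢_)
open import Function.Bundles using (_↔_; Inverse)

-- A multinomial has `size` terms (indexed by Fin size); each term carries
-- its monomial, i.e. its exponent vector in ℕ^d.  (Repeated monomials
-- encode positive integer coefficients.)

record Multinomial (d : ℕ) : Set where
  field
    size : ℕ
    deg  : Fin size → Vec ℕ d

open Multinomial public

Term : ∀ {d} → Multinomial d → Set
Term P = Fin (size P)

_⊕_ : ∀ {d} → Vec ℕ d → Vec ℕ d → Vec ℕ d
_⊕_ = zipWith Data.Nat._+_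

prodDeg : ∀ {d} (P Q : Multinomial d) → Term P × Term Q → Vec ℕ d
prodDeg P Q (p , q) = deg P p ⊕ deg Q q

-- F : P × R ≡ Q × R : a bijection (with its inverse) between the terms
-- of P · R and of Q · R which matches terms, i.e. preserves monomials.
record Matching {d} (P Q R : Multinomial d) : Set where
  field
    bij      : (Term P × Term R) ↔ (Term Q × Term R)
    preserve : ∀ t → prodDeg Q R (Inverse.to bij t) ≡ prodDeg P R t

dot : ∀ {d} → Vec ℤ d → Vec ℕ d → ℤ
dot []      []      = + 0
dot (l ∷ ls) (e ∷ es) = l * (+ e) + dot ls es

Extreme : ∀ {d} (C : Multinomial d) → Term C → Set
Extreme C ω = Σ (Vec ℤ _) λ lam →
  ∀ c → c ≢ ω → dot lam (deg C c) < dot lam (deg C ω)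

-- xdiv((F,G),ω) = (f,g) as partial functions, given by their big-step
-- (terminating) evaluation relations.
--   FEval x r   : f(x) terminates and returns r
--   FLoop s r   : the while-loop of f, started in state s = (y,z),
--                 terminates and returns r
-- and symmetrically for g.

module Xdiv {A B C : Set} (F : A × C → B × C) (G : B × C → A × C) (ω : C) where

  data FEval : A → B → Set
  data GEval : B → A → Set
  data FLoop : B × C → B → Set
  data GLoop : A × C → A → Set

  data FEval where
    run : ∀ {x r} → FLoop (F (x , ω)) r → FEval x r

  data GEval where
    run : ∀ {x r} → GLoop (G (x , ω)) r → GEval x r

  data FLoop where
    done : ∀ {y} → FLoop (y , ω) y
    step : ∀ {y z y' r} → z ≢ ω → GEval y y' → FLoop (F (y' , z)) r → FLoop (y , z) r

  data GLoop where
    done : ∀ {y} → GLoop (y , ω) y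
    step : ∀ {y z y' r} → z ≢ ω → FEval y y' → GLoop (G (y' , z)) r → GLoop (y , z) r

  XDivisible : Set
  XDivisible = (∀ x → ∃ λ r → FEval x r) × (∀ y → ∃ λ r → GEval y r)

-- Fuse f and g into one procedure h on A ⊎ B, driven by the injective self-map Φ = F ⊎ G of
-- (A ⊎ B) × C.  A linear function λ with unique maximum at ω weighs every term, and Φ preserves
-- the weight of pairs.  While the loop computing h(x) runs, its state (y, z) has the weight of
-- (x, ω), so z ≠ ω forces λ(y) > λ(x): every recursive call is made on a strictly heavier
-- argument, and there are only finitely many weights.  Within one call, h is injective, so every
-- state of the loop has a unique predecessor and the start state Φ(x, ω) has none; a trajectory of
-- such a system in a finite set cannot cycle, hence it reaches a state with z = ω.
module Submission where

open import Defs
open import Data.Nat using (ℕ)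
import Data.Nat as ℕ
open import Data.Integer using (ℤ; +_; _+_; _*_; _<_)
import Data.Integer.Properties as ℤ
open import Algebra.Bundles using (AbelianGroup)
open import Algebra.Properties.CommutativeSemigroup ℤ.+-commutativeSemigroup using (interchange)
open import Algebra.Properties.Group (AbelianGroup.group ℤ.+-0-abelianGroup) using (∙-cancelʳ)
open import Data.Fin using (Fin) renaming (_≟_ to _≟ᶠ_)
open import Data.Fin.Induction using (spo-wellFounded)
open import Data.Fin.Properties using (+↔⊎; *↔×)
open import Data.Vec using (Vec; []; _∷_)
open import Data.Product using (_×_; _,_; proj₁; proj₂; ∃; ∃₂; map₁; map₂)
open import Data.Product.Properties using (×-≡,≡→≡)
open import Data.Product.Function.NonDependent.Propositional using (_×-↣_)
open import Data.Sum using (_⊎_; inj₁; inj₂; [_,_]′)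
open import Data.Sum.Properties using (inj₁-injective; inj₂-injective)
open import Data.Sum.Function.Propositional using (_⊎-↣_)
open import Data.Empty using (⊥-elim)
open import Function using (id; _∘_; flip)
open import Function.Bundles using (Inverse; Injection; _↣_)
open import Function.Definitions using (Injective)
open import Function.Construct.Composition using (_↣-∘_)
open import Function.Construct.Identity using (↣-id)
open import Function.Properties.Inverse using (↔⇒↣; ↔-sym)
open import Induction.WellFounded
  using (WellFounded; WfRec; Acc; acc; module Subrelation; module All)
open import Level using (0ℓ)
import Relation.Binary.Construct.On as On
open import Relation.Binary.Construct.Closure.ReflexiveTransitive
  using (Star; ε; _◅_; _◅◅_; reverse)
open import Relation.Binary.Construct.Closure.Transitive
  using (TransClosure; [_]; _∷_; _∷ʳ_; _++_)
open import Relation.Binary.Core using (Rel)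
open import Relation.Binary.Definitions using (Transitive; DecidableEquality)
open import Relation.Binary.Structures using (IsStrictPartialOrder)
open import Relation.Binary.PropositionalEquality
open import Relation.Nullary using (¬_; yes; no)
open import Relation.Nullary.Decidable using (via-injection)

finite⇒wellFounded : ∀ {S : Set} {n} {_⊏_ : Rel S 0ℓ} → S ↣ Fin n →
                     Transitive _⊏_ → (∀ {x} → ¬ x ⊏ x) → WellFounded _⊏_
finite⇒wellFounded {S} {n} {_⊏_} enc ⊏-trans ⊏-irrefl =
  Subrelation.wellFounded (λ {x} {y} x⊏y → x , y , refl , refl , x⊏y)
    (On.wellFounded to (spo-wellFounded image-isStrictPartialOrder))
  where
  open Injection enc using (to; injective)

  _⊏ᶠ_ : Rel (Fin n) 0ℓ
  i ⊏ᶠ j = ∃₂ λ x y → to x ≡ i × to y ≡ j × x ⊏ y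

  image-isStrictPartialOrder : IsStrictPartialOrder _≡_ _⊏ᶠ_
  image-isStrictPartialOrder = record
    { isEquivalence = isEquivalence
    ; irrefl        = λ { refl (x , y , refl , y↦ , x⊏y) →
                          ⊏-irrefl (subst (x ⊏_) (injective y↦) x⊏y) }
    ; trans         = λ { (x , y , x↦ , refl , x⊏y) (y′ , z , y′↦ , z↦ , y′⊏z) →
                          x , z , x↦ , z↦ , ⊏-trans x⊏y (subst (_⊏ z) (injective y′↦) y′⊏z) }
    ; <-resp-≈      = (λ { refl i⊏j → i⊏j }) , (λ { refl i⊏j → i⊏j })
    }

TransClosure-rotate : ∀ {S : Set} {R : Rel S 0ℓ} {x} →
                      TransClosure R x x → ∃ λ y → R x y × TransClosure R y y
TransClosure-rotate [ xRx ]      = _ , xRx , [ xRx ]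
TransClosure-rotate (xRy ∷ yR⁺x) = _ , xRy , yR⁺x ∷ʳ xRy

-- A state t is reached from s₀ by a backward path Star (flip _↝_) t s₀, whose first link is the
-- step entering t.
module _ {S : Set} {_↝_ : Rel S 0ℓ}
         (↝-backward-injective : ∀ {m m′ t} → m ↝ t → m′ ↝ t → m ≡ m′)
         {s₀ : S} (s₀-initial : ∀ {m} → ¬ m ↝ s₀) where

  private
    _↜_ : Rel S 0ℓ
    _↜_ = flip _↝_

  reached⇒acyclic : ∀ {u} → Star _↜_ u s₀ → ¬ TransClosure _↜_ u u
  reached⇒acyclic ε cycle with TransClosure-rotate cycle
  ... | _ , m↝s₀ , _ = s₀-initial m↝s₀
  reached⇒acyclic (m↝u ◅ reached) cycle with TransClosure-rotate cycle
  ... | _ , m′↝u , cycle′ with ↝-backward-injective m′↝u m↝u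
  ...   | refl = reached⇒acyclic reached cycle′

  progress⇒reaches : ∀ {n} → S ↣ Fin n → (P : S → Set) →
                     (∀ {t} → Star _↜_ t s₀ → P t ⊎ ∃ (t ↝_)) →
                     ∃ λ t → P t × Star _↝_ s₀ t
  progress⇒reaches finite P progress = go s₀ ε (later-wellFounded s₀)
    where
    _⊏_ : Rel S 0ℓ
    t ⊏ u = Star _↜_ u s₀ × TransClosure _↜_ t u

    later-wellFounded : WellFounded _⊏_
    later-wellFounded = finite⇒wellFounded finite
      (λ (_ , t↜⁺u) (v-reached , u↜⁺v) → v-reached , t↜⁺u ++ u↜⁺v)
      (λ (reached , cycle) → reached⇒acyclic reached cycle)

    go : ∀ t → Star _↜_ t s₀ → Acc _⊏_ t → ∃ λ f → P f × Star _↝_ t f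
    go t reached (acc later) with progress reached
    ... | inj₁ Pt = t , Pt , ε
    ... | inj₂ (u , t↝u) with go u (t↝u ◅ reached) (later (reached , [ t↝u ]))
    ...   | f , Pf , u↝⋆f = f , Pf , t↝u ◅ u↝⋆f

_⊞_ : ∀ {X C : Set} → (X → ℤ) → (C → ℤ) → X × C → ℤ
(L ⊞ ℓ) p = L (proj₁ p) + ℓ (proj₂ p)

-- xdiv for a single self-map Φ: h runs the loop of f, with both F and G replaced by Φ and
-- both f and g by h.
module SelfXdiv {X C : Set} (Φ : X × C → X × C) (ω : C) where

  data Eval : X → X → Set
  data Loop : X × C → X → Set

  data Eval where
    run : ∀ {x r} → Loop (Φ (x , ω)) r → Eval x r

  data Loop where
    done : ∀ {y} → Loop (y , ω) y
    step : ∀ {y z y′ r} → z ≢ ω → Eval y y′ → Loop (Φ (y′ , z)) r → Loop (y , z) r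

  data _↝_ : Rel (X × C) 0ℓ where
    step : ∀ {y z y′ t} → z ≢ ω → Eval y y′ → t ≡ Φ (y′ , z) → (y , z) ↝ t

  _↜_ : Rel (X × C) 0ℓ
  _↜_ = flip _↝_

  Loop⇒trajectory : ∀ {s r} → Loop s r → Star _↝_ s (r , ω)
  Loop⇒trajectory done              = ε
  Loop⇒trajectory (step z≢ω e loop) = step z≢ω e refl ◅ Loop⇒trajectory loop

  trajectory⇒Loop : ∀ {s r} → Star _↝_ s (r , ω) → Loop s r
  trajectory⇒Loop ε                        = done
  trajectory⇒Loop (step z≢ω e refl ◅ path) = step z≢ω e (trajectory⇒Loop path)

  module _ (Φ-injective : Injective _≡_ _≡_ Φ) where

    start-initial : ∀ {m x} → ¬ m ↝ Φ (x , ω)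
    start-initial (step z≢ω _ eq) = z≢ω (cong proj₂ (Φ-injective (sym eq)))

    backward-from-start : ∀ {x s} → Star _↜_ (Φ (x , ω)) s → s ≡ Φ (x , ω)
    backward-from-start ε             = refl
    backward-from-start (m↝start ◅ _) = ⊥-elim (start-initial m↝start)

    mutual
      Eval-injective : ∀ {x x′ r} → Eval x r → Eval x′ r → x ≡ x′
      Eval-injective (run loop) (run loop′) with Loop-comparable loop loop′
      ... | inj₁ path = cong proj₁ (Φ-injective (sym (backward-from-start path)))
      ... | inj₂ path = cong proj₁ (Φ-injective (backward-from-start path))

      -- Two loops with the same result run backwards in lockstep from (r, ω), so the start state
      -- of one lies on the trajectory of the other.
      Loop-comparable : ∀ {s s′ r} → Loop s r → Loop s′ r → Star _↜_ s s′ ⊎ Star _↜_ s′ s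
      Loop-comparable done loop′ = inj₁ (reverse id (Loop⇒trajectory loop′))
      Loop-comparable (step z≢ω e loop) loop′ with Loop-comparable loop loop′
      ... | inj₂ path         = inj₂ (path ◅◅ step z≢ω e refl ◅ ε)
      ... | inj₁ ε            = inj₂ (step z≢ω e refl ◅ ε)
      ... | inj₁ (m↝u ◅ path) with predecessor-unique e m↝u
      ...   | refl            = inj₁ path

      predecessor-unique : ∀ {y y′ z m} → Eval y y′ → m ↝ Φ (y′ , z) → m ≡ (y , z)
      predecessor-unique e (step _ e′ eq) with Φ-injective eq
      ... | refl with Eval-injective e e′
      ...   | refl = refl

    ↝-backward-injective : ∀ {m m′ t} → m ↝ t → m′ ↝ t → m ≡ m′
    ↝-backward-injective (step _ e refl) m′↝t = sym (predecessor-unique e m′↝t)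

  module _ (L : X → ℤ) (ℓ : C → ℤ) (Φ-weight : ∀ p → (L ⊞ ℓ) (Φ p) ≡ (L ⊞ ℓ) p) where

    Φ-step-weight : ∀ {y y′ z} → L y′ ≡ L y → (L ⊞ ℓ) (Φ (y′ , z)) ≡ L y + ℓ z
    Φ-step-weight {z = z} Ly′≡Ly = trans (Φ-weight _) (cong (_+ ℓ z) Ly′≡Ly)

    mutual
      Eval-weight : ∀ {x r} → Eval x r → L r ≡ L x
      Eval-weight {x} (run loop) =
        ∙-cancelʳ (ℓ ω) _ _ (trans (Loop-weight loop) (Φ-weight (x , ω)))

      Loop-weight : ∀ {s r} → Loop s r → L r + ℓ ω ≡ (L ⊞ ℓ) s
      Loop-weight done            = refl
      Loop-weight (step _ e loop) = trans (Loop-weight loop) (Φ-step-weight (Eval-weight e))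

    reached-weight : ∀ {s t} → Star _↜_ t s → (L ⊞ ℓ) t ≡ (L ⊞ ℓ) s
    reached-weight ε                         = refl
    reached-weight (step _ e refl ◅ reached) =
      trans (Φ-step-weight (Eval-weight e)) (reached-weight reached)

    module _ (ω-maximum : ∀ z → z ≢ ω → ℓ z < ℓ ω) where

      reached⇒heavier : ∀ {x y z} → Star _↜_ (y , z) (Φ (x , ω)) → z ≢ ω → L x < L y
      reached⇒heavier {x} {y} {z} reached z≢ω = ℤ.≰⇒> λ Ly≤Lx → ℤ.<-irrefl
        (trans (reached-weight reached) (Φ-weight (x , ω)))
        (ℤ.+-mono-≤-< Ly≤Lx (ω-maximum z z≢ω))

      module _ {n m} (X-finite : X ↣ Fin n) (C-finite : C ↣ Fin m)
               (Φ-injective : Injective _≡_ _≡_ Φ) where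

        _≟_ : DecidableEquality C
        _≟_ = via-injection C-finite _≟ᶠ_

        _≺_ : Rel X 0ℓ
        y ≺ x = L x < L y

        Eval-from-heavier : ∀ x → WfRec _≺_ (∃ ∘ Eval) x → ∃ (Eval x)
        Eval-from-heavier x heavier
          with progress⇒reaches (↝-backward-injective Φ-injective) (start-initial Φ-injective)
                 (↔⇒↣ (↔-sym *↔×) ↣-∘ (X-finite ×-↣ C-finite)) ((_≡ ω) ∘ proj₂) progress
          where
          progress : ∀ {t} → Star _↜_ t (Φ (x , ω)) → proj₂ t ≡ ω ⊎ ∃ (t ↝_)
          progress {y , z} reached with z ≟ ω
          ... | yes z≡ω = inj₁ z≡ω
          ... | no z≢ω  =
            inj₂ (_ , step z≢ω (proj₂ (heavier (reached⇒heavier reached z≢ω))) refl)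
        ... | (r , _) , refl , path = r , run (trajectory⇒Loop path)

        Eval-total : ∀ x → ∃ (Eval x)
        Eval-total = All.wfRec (finite⇒wellFounded X-finite (flip ℤ.<-trans) (ℤ.<-irrefl refl))
                               0ℓ (∃ ∘ Eval) Eval-from-heavier

module _ {A B C : Set} (F : A × C → B × C) (G : B × C → A × C) (ω : C) where

  interleave : (A ⊎ B) × C → (A ⊎ B) × C
  interleave (inj₁ a , z) = map₁ inj₂ (F (a , z))
  interleave (inj₂ b , z) = map₁ inj₁ (G (b , z))

  interleave-injective : Injective _≡_ _≡_ F → Injective _≡_ _≡_ G →
                         Injective _≡_ _≡_ interleave
  interleave-injective F-injective _ {inj₁ a , z} {inj₁ a′ , z′} eq
    with refl ← F-injective (×-≡,≡→≡ (inj₂-injective (cong proj₁ eq) , cong proj₂ eq)) = refl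
  interleave-injective _ G-injective {inj₂ b , z} {inj₂ b′ , z′} eq
    with refl ← G-injective (×-≡,≡→≡ (inj₁-injective (cong proj₁ eq) , cong proj₂ eq)) = refl
  interleave-injective _ _ {inj₁ _ , _} {inj₂ _ , _} eq with () ← cong proj₁ eq
  interleave-injective _ _ {inj₂ _ , _} {inj₁ _ , _} eq with () ← cong proj₁ eq

  open Xdiv F G ω
  open SelfXdiv interleave ω using (Eval; Loop; run; done; step; Eval-total)

  mutual
    Eval⇒FEval : ∀ {x r} → Eval (inj₁ x) r → ∃ λ b → r ≡ inj₂ b × FEval x b
    Eval⇒FEval (run loop) with Loop⇒FLoop loop
    ... | b , refl , loop′ = b , refl , run loop′

    Eval⇒GEval : ∀ {y r} → Eval (inj₂ y) r → ∃ λ a → r ≡ inj₁ a × GEval y a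
    Eval⇒GEval (run loop) with Loop⇒GLoop loop
    ... | a , refl , loop′ = a , refl , run loop′

    Loop⇒FLoop : ∀ {y z r} → Loop (inj₂ y , z) r → ∃ λ b → r ≡ inj₂ b × FLoop (y , z) b
    Loop⇒FLoop done = _ , refl , done
    Loop⇒FLoop (step z≢ω e loop) with Eval⇒GEval e
    ... | _ , refl , ge with Loop⇒FLoop loop
    ...   | b , refl , loop′ = b , refl , step z≢ω ge loop′

    Loop⇒GLoop : ∀ {x z r} → Loop (inj₁ x , z) r → ∃ λ a → r ≡ inj₁ a × GLoop (x , z) a
    Loop⇒GLoop done = _ , refl , done
    Loop⇒GLoop (step z≢ω e loop) with Eval⇒FEval e
    ... | _ , refl , fe with Loop⇒GLoop loop
    ...   | a , refl , loop′ = a , refl , step z≢ω fe loop′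

  X-divisible : ∀ {a b c} → A ↣ Fin a → B ↣ Fin b → C ↣ Fin c →
                Injective _≡_ _≡_ F → Injective _≡_ _≡_ G →
                (ℓA : A → ℤ) (ℓB : B → ℤ) (ℓC : C → ℤ) →
                (∀ p → (ℓB ⊞ ℓC) (F p) ≡ (ℓA ⊞ ℓC) p) →
                (∀ p → (ℓA ⊞ ℓC) (G p) ≡ (ℓB ⊞ ℓC) p) →
                (∀ z → z ≢ ω → ℓC z < ℓC ω) →
                XDivisible
  X-divisible A-finite B-finite C-finite F-injective G-injective
              ℓA ℓB ℓC F-weight G-weight ω-maximum =
    (λ x → map₂ proj₂ (Eval⇒FEval (proj₂ (total (inj₁ x))))) ,
    (λ y → map₂ proj₂ (Eval⇒GEval (proj₂ (total (inj₂ y)))))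
    where
    interleave-weight : ∀ p → ([ ℓA , ℓB ]′ ⊞ ℓC) (interleave p) ≡ ([ ℓA , ℓB ]′ ⊞ ℓC) p
    interleave-weight (inj₁ a , z) = F-weight (a , z)
    interleave-weight (inj₂ b , z) = G-weight (b , z)

    total : ∀ x → ∃ (Eval x)
    total = Eval-total [ ℓA , ℓB ]′ ℓC interleave-weight ω-maximum
      (↔⇒↣ (↔-sym +↔⊎) ↣-∘ (A-finite ⊎-↣ B-finite)) C-finite
      (interleave-injective F-injective G-injective)

dot-⊕ : ∀ {n} (w : Vec ℤ n) u v → dot w (u ⊕ v) ≡ dot w u + dot w v
dot-⊕ []      []      []      = refl
dot-⊕ (l ∷ w) (e ∷ u) (f ∷ v) = begin
  l * + (e ℕ.+ f) + dot w (u ⊕ v)            ≡⟨ cong₂ _+_ (cong (l *_) (ℤ.pos-+ e f)) (dot-⊕ w u v) ⟩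
  l * (+ e + + f) + (dot w u + dot w v)      ≡⟨ cong (_+ _) (ℤ.*-distribˡ-+ l (+ e) (+ f)) ⟩
  (l * + e + l * + f) + (dot w u + dot w v)  ≡⟨ interchange (l * + e) (l * + f) (dot w u) (dot w v) ⟩
  (l * + e + dot w u) + (l * + f + dot w v)  ∎
  where open ≡-Reasoning

weight : ∀ {d} → Vec ℤ d → (P : Multinomial d) → Term P → ℤ
weight w P = dot w ∘ deg P

module _ {d} {P Q R : Multinomial d} (M : Matching P Q R) where
  open Matching M
  open Inverse bij using (to)

  Matching-injective : Injective _≡_ _≡_ to
  Matching-injective = Injection.injective (↔⇒↣ bij)

  Matching-weight : ∀ w t → (weight w Q ⊞ weight w R) (to t) ≡ (weight w P ⊞ weight w R) t
  Matching-weight w t = begin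
    (weight w Q ⊞ weight w R) (to t)  ≡⟨ dot-⊕ w _ _ ⟨
    dot w (prodDeg Q R (to t))        ≡⟨ cong (dot w) (preserve t) ⟩
    dot w (prodDeg P R t)             ≡⟨ dot-⊕ w _ _ ⟩
    (weight w P ⊞ weight w R) t       ∎
    where open ≡-Reasoning

proposition9 : (d : ℕ) (A B C : Multinomial d)
               (F : Matching A B C) (G : Matching B A C)
               (ω : Term C) → Extreme C ω →
               Xdiv.XDivisible (Inverse.to (Matching.bij F)) (Inverse.to (Matching.bij G)) ω
proposition9 d A B C F G ω (w , ω-maximum) =
  X-divisible _ _ ω (↣-id _) (↣-id _) (↣-id _) (Matching-injective F) (Matching-injective G)
    (weight w A) (weight w B) (weight w C) (Matching-weight F w) (Matching-weight G w) ω-maximum
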